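{- Let $\mathcal{A}$ be a timed automaton game and $\Omega:S\to\{0,\dots,d-1\}$ a parity index function on its states. Consider the enlarged structure $\widehat{\mathcal A}_{td}$ and define on its states the parity index function $\Omega_{td}(\langle s,\mathfrak z,\mathrm{tick},\mathrm{bl}_1,p\rangle)=0$ if $\mathrm{tick}=\mathrm{bl}_1=\mathrm{false}$, $=1$ if $\mathrm{tick}=\mathrm{false}$ and $\mathrm{bl}_1=\mathrm{true}$, and $=p+2$ if $\mathrm{tick}=\mathrm{true}$; extend $\Omega$ to states of $\widehat{\mathcal A}_{td}$ by $\Omega(\langle s,\mathfrak z,\mathrm{tick},\mathrm{bl}_1,p\rangle)=\Omega(s)$. Then for every run $\widehat r$ of $\widehat{\mathcal A}_{td}$: $\widehat r$ satisfies $(\Box\Diamond\mathrm{tick}\rightarrow\mathrm{Parity}(\Omega))\wedge(\neg\Box\Diamond\mathrm{tick}\rightarrow\Diamond\Box\neg\mathrm{bl}_1)$ if and only if $\widehat r\in\mathrm{Parity}(\Omega_{td})$. (Hence, in $\widehat{\mathcal A}_{td}$, $\mathrm{TimeDivBl}_1(\mathrm{Parity}(\Omega))=\mathrm{Parity}(\Omega_{td})$.)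
   Context: A timed automaton game is $\mathcal{A}=\langle L,C,A_1,A_2,E,\gamma\rangle$: $L$ a finite set of locations; $C$ a finite set of clocks; $A_1,A_2$ disjoint finite action sets of player 1 and player 2 (not containing $\bot_1,\bot_2,\bot_*$); $E\subseteq L\times(A_1\cup A_2)\times\mathrm{Constr}(C)\times L\times 2^C$ a set of edges (clock constraints generated by $\theta::=x\le d\mid d\le x\mid\neg\theta\mid\theta_1\wedge\theta_2$, $d\in\mathbb{N}$; distinct edges from a location carry distinct actions); $\gamma:L\to\mathrm{Constr}(C)$ invariants. States are $\langle l,\kappa\rangle$ with $\kappa:C\to\mathbb{R}_{\ge0}$, $\kappa\models\gamma(l)$; $S$ is the set of states. At $s=\langle l,\kappa\rangle$ player $i$'s moves $\Gamma_i(s)$ are: $\langle\Delta,\bot_i\rangle$ if $\kappa+\Delta'\models\gamma(l)$ for all $0\le\Delta'\le\Delta$; $\langle\Delta,a_i\rangle$, $a_i\in A_i$, if moreover some edge $\langle l,a_i,\theta,l',\lambda\rangle$ has $\kappa+\Delta\models\theta$; and for player 1 also $\langle0,\bot_*\rangle$. $\delta(s,\langle\Delta,\bot_*\rangle)=s$, $\delta(\langle l,\kappa\rangle,\langle\Delta,\bot_i\rangle)=\langle l,\kappa+\Delta\rangle$, $\delta(\langle l,\kappa\rangle,\langle\Delta,a_i\rangle)=\langle l',(\kappa+\Delta)[\lambda:=0]\rangle$. If both players propose $m_1=\langle\Delta_1,a_1\rangle,m_2=\langle\Delta_2,a_2\rangle$, the move of player 1 determines the successor if $a_1\ne\bot_*$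 and $\Delta_1<\Delta_2$, the move of player 2 if $\Delta_2<\Delta_1$ or $a_1=\bot_*$, and either one if $\Delta_1=\Delta_2$ and $a_1\neq\bot_*$. The enlarged structure $\widehat{\mathcal A}_{td}$ has states $\langle s,\mathfrak z,\mathrm{tick},\mathrm{bl}_1,p\rangle$ with $s\in S$, $\mathfrak z\in[0,1)$, booleans $\mathrm{tick},\mathrm{bl}_1$, and $p\in\{0,\dots,d-1\}$; the moves available are those of $s$ in $\mathcal A$, the round resolution is the same as in $\mathcal A$, and the move $\langle\Delta,a_i\rangle$ of player $i$, when it determines the successor, leads from $\langle s,\mathfrak z,\mathrm{tick},\mathrm{bl}_1,p\rangle$ to $\langle s',\mathfrak z',\mathrm{tick}',\mathrm{bl}_1',p'\rangle$ with $s'=\delta(s,\langle\Delta,a_i\rangle)$, $\mathfrak z'$ the fractional part of $\mathfrak z+\Delta$, $\mathrm{tick}'$ true iff $\mathfrak z+\Delta\ge1$, $\mathrm{bl}_1'$ true iff $i=1$, and $p'=\max(p,\Omega(s'))$ if $\mathrm{tick}=\mathrm{false}$, $p'=\Omega(s')$ if $\mathrm{tick}=\mathrm{true}$. For a parity index function $\Omega'$, $\mathrm{Parity}(\Omega')$ is the set of runs whose largest index occurring infinitely often is even. $\Box\Diamond$ means "infinitely often" and $\Diamond\Box$ "at all but finitely many positions". $\mathrm{TimeDivBl}_1(\Phi)$ denotes the runs that are time-divergent and in $\Phi$, or are not time-divergent and in which player 1 is responsible for only finitely many transitions. -}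

module Defs where

open import Level using (0ℓ)
open import Data.Nat as ℕ using (ℕ; zero; suc; _⊔_)
open import Data.Nat.Divisibility using (_∣_)
open import Data.Nat.Base using () renaming (_≤_ to _≤ℕ_; _<_ to _<ℕ_)
open import Data.Fin using (Fin; toℕ)
open import Data.Fin.Subset using (Subset; _∈_; _∉_)
open import Data.Bool using (Bool; true; false)
open import Data.List using (List)
open import Data.Maybe using (Maybe; nothing; just)
open import Data.List.Membership.Propositional using () renaming (_∈_ to _∈ₗ_)
open import Data.Product using (Σ; ∃; ∃-syntax; _×_; _,_)
open import Data.Sum using (_⊎_; inj₁; inj₂)
open import Data.Empty using (⊥)
open import Relation.Nullary using (¬_)
open import Relation.Binary.PropositionalEquality using (_≡_)
open import Algebra.Structures using (IsCommutativeRing)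
open import Relation.Binary.Structures using (IsStrictTotalOrder)

-- Real numbers: an ordered commutative ring with a floor function.
-- (Abstract interface; the theorem is stated for every such structure,
-- in particular for ℝ.)

record Reals : Set₁ where
  infixl 6 _+_ _-_
  infixl 7 _*_
  infix 4 _<_ _≤_
  field
    Carrier : Set
    _+_ _*_ : Carrier → Carrier → Carrier
    -_ : Carrier → Carrier
    0# 1# : Carrier
    _<_ : Carrier → Carrier → Set
    isCommutativeRing : IsCommutativeRing _≡_ _+_ _*_ -_ 0# 1#
    isStrictTotalOrder : IsStrictTotalOrder _≡_ _<_
    +-mono-< : ∀ {x y} z → x < y → x + z < y + z
    *-pos : ∀ {x y} → 0# < x → 0# < y → 0# < x * y
    fromℕ : ℕ → Carrier
    fromℕ-zero : fromℕ zero ≡ 0#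
    fromℕ-suc : ∀ n → fromℕ (suc n) ≡ 1# + fromℕ n
    ⌊_⌋ : Carrier → ℕ
    floor-≤ : ∀ x → (0# < x ⊎ 0# ≡ x) → (fromℕ ⌊ x ⌋ < x ⊎ fromℕ ⌊ x ⌋ ≡ x)
    floor-< : ∀ x → (0# < x ⊎ 0# ≡ x) → x < fromℕ (suc ⌊ x ⌋)

  _-_ : Carrier → Carrier → Carrier
  x - y = x + (- y)

  _≤_ : Carrier → Carrier → Set
  x ≤ y = x < y ⊎ x ≡ y

  -- fractional part (used for non-negative arguments)
  frac : Carrier → Carrier
  frac x = x - fromℕ ⌊ x ⌋

data Constr (nC : ℕ) : Set where
  _≤c_ : Fin nC → ℕ → Constr nC
  _c≤_ : ℕ → Fin nC → Constr nC
  ¬c_  : Constr nC → Constr nC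
  _∧c_ : Constr nC → Constr nC → Constr nC

-- edges ⟨l, a, θ, l', λ⟩ ; actions of player 1 are inj₁, of player 2 inj₂
record Edge (nL nC n₁ n₂ : ℕ) : Set where
  constructor edge
  field
    src    : Fin nL
    act    : Fin n₁ ⊎ Fin n₂
    guard  : Constr nC
    tgt    : Fin nL
    reset  : Subset nC

-- L = Fin nL, C = Fin nC, A₁ = Fin n₁, A₂ = Fin n₂
record TAGame : Set where
  field
    nL nC n₁ n₂ : ℕ
    edges : List (Edge nL nC n₁ n₂)
    inv   : Fin nL → Constr nC
    edges-det : ∀ {e e'} → e ∈ₗ edges → e' ∈ₗ edges →
                Edge.src e ≡ Edge.src e' → Edge.act e ≡ Edge.act e' → e ≡ e'

data Act₁ (n₁ : ℕ) : Set where
  ⊥₁ ⊥* : Act₁ n₁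
  act₁  : Fin n₁ → Act₁ n₁

data Act₂ (n₂ : ℕ) : Set where
  ⊥₂   : Act₂ n₂
  act₂ : Fin n₂ → Act₂ n₂

module _ (R : Reals) where
  open Reals R

  module _ (G : TAGame) where
    open TAGame G

    Valuation : Set
    Valuation = Fin nC → Carrier

    _⊨_ : Valuation → Constr nC → Set
    κ ⊨ (x ≤c d) = κ x ≤ fromℕ d
    κ ⊨ (d c≤ x) = fromℕ d ≤ κ x
    κ ⊨ (¬c θ)   = ¬ (κ ⊨ θ)
    κ ⊨ (θ ∧c θ') = (κ ⊨ θ) × (κ ⊨ θ')

    _+ᵥ_ : Valuation → Carrier → Valuation
    (κ +ᵥ Δ) x = κ x + Δ

    -- raw pairs ⟨l, κ⟩; the states S are those satisfying IsState
    record RawState : Set where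
      constructor ⟨_,_⟩
      field
        loc : Fin nL
        val : Valuation

    IsState : RawState → Set
    IsState ⟨ l , κ ⟩ = (∀ x → 0# ≤ κ x) × (κ ⊨ inv l)

    CanWait : RawState → Carrier → Set
    CanWait ⟨ l , κ ⟩ Δ = 0# ≤ Δ × (∀ Δ' → 0# ≤ Δ' → Δ' ≤ Δ → (κ +ᵥ Δ') ⊨ inv l)

    EnabledEdge : RawState → Carrier → Fin n₁ ⊎ Fin n₂ → Edge nL nC n₁ n₂ → Set
    EnabledEdge ⟨ l , κ ⟩ Δ a e =
      e ∈ₗ edges × Edge.src e ≡ l × Edge.act e ≡ a × ((κ +ᵥ Δ) ⊨ Edge.guard e)

    Move₁ : Set
    Move₁ = Carrier × Act₁ n₁
    Move₂ : Set
    Move₂ = Carrier × Act₂ n₂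

    InΓ₁ : RawState → Move₁ → Set
    InΓ₁ s (Δ , ⊥₁) = CanWait s Δ
    InΓ₁ s (Δ , ⊥*) = Δ ≡ 0#
    InΓ₁ s (Δ , act₁ a) = CanWait s Δ × ∃[ e ] EnabledEdge s Δ (inj₁ a) e

    InΓ₂ : RawState → Move₂ → Set
    InΓ₂ s (Δ , ⊥₂) = CanWait s Δ
    InΓ₂ s (Δ , act₂ a) = CanWait s Δ × ∃[ e ] EnabledEdge s Δ (inj₂ a) e

    -- s' (pointwise) equals δ(s, ⟨Δ, a⟩) for a ∈ A₁ ∪ A₂ ∪ {⊥₁, ⊥₂}
    -- (nothing encodes ⊥ᵢ)
    Delta : RawState → Carrier → Maybe (Fin n₁ ⊎ Fin n₂) → RawState → Set
    Delta ⟨ l , κ ⟩ Δ nothing ⟨ l' , κ' ⟩ = l' ≡ l × (∀ x → κ' x ≡ κ x + Δ)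
    Delta s@(⟨ l , κ ⟩) Δ (just a) ⟨ l' , κ' ⟩ =
      ∃[ e ] (EnabledEdge s Δ a e × l' ≡ Edge.tgt e ×
              (∀ x → x ∈ Edge.reset e → κ' x ≡ 0#) ×
              (∀ x → x ∉ Edge.reset e → κ' x ≡ κ x + Δ))

    act₁→ : Act₁ n₁ → Maybe (Fin n₁ ⊎ Fin n₂)
    act₁→ ⊥₁ = nothing
    act₁→ ⊥* = nothing   -- never used: ⊥* never determines the successor
    act₁→ (act₁ a) = just (inj₁ a)

    act₂→ : Act₂ n₂ → Maybe (Fin n₁ ⊎ Fin n₂)
    act₂→ ⊥₂ = nothing
    act₂→ (act₂ a) = just (inj₂ a)

    Determines₁ : Move₁ → Move₂ → Set
    Determines₁ (Δ₁ , a₁) (Δ₂ , a₂) = ¬ (a₁ ≡ ⊥*) × (Δ₁ < Δ₂ ⊎ Δ₁ ≡ Δ₂)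

    Determines₂ : Move₁ → Move₂ → Set
    Determines₂ (Δ₁ , a₁) (Δ₂ , a₂) =
      Δ₂ < Δ₁ ⊎ a₁ ≡ ⊥* ⊎ (Δ₁ ≡ Δ₂ × ¬ (a₁ ≡ ⊥*))

    module _ (d : ℕ) (Ω : RawState → Fin d) where

      record EState : Set where
        constructor ⟪_,_,_,_,_⟫
        field
          st   : RawState
          𝔷    : Carrier
          tick : Bool
          bl₁  : Bool
          p    : Fin d

      IsEState : EState → Set
      IsEState ⟪ s , z , t , b , p ⟫ = IsState s × 0# ≤ z × z < 1#

      Ωℕ : RawState → ℕ
      Ωℕ s = toℕ (Ω s)

      -- successor determined by a move ⟨Δ, ·⟩ of player i (bl = (i = 1))
      -- leading in A to the state s'
      ESucc : EState → Carrier → Bool → EState → Set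
      ESucc ⟪ s , z , t , b , p ⟫ Δ bl ⟪ s' , z' , t' , b' , p' ⟫ =
        z' ≡ frac (z + Δ) ×
        (t' ≡ true → 1# ≤ z + Δ) × (1# ≤ z + Δ → t' ≡ true) ×
        b' ≡ bl ×
        PUpd t p
        where
          PUpd : Bool → Fin d → Set
          PUpd false p = toℕ p' ≡ toℕ p ⊔ Ωℕ s'
          PUpd true  p = toℕ p' ≡ Ωℕ s'

      EStep : EState → EState → Set
      EStep ŝ ŝ' =
        ∃[ m₁ ] ∃[ m₂ ] (InΓ₁ s m₁ × InΓ₂ s m₂ ×
          ((Determines₁ m₁ m₂ × Delta s (Data.Product.proj₁ m₁) (act₁→ (Data.Product.proj₂ m₁)) s'
              × ESucc ŝ (Data.Product.proj₁ m₁) true ŝ')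
           ⊎ (Determines₂ m₁ m₂ × Delta s (Data.Product.proj₁ m₂) (act₂→ (Data.Product.proj₂ m₂)) s'
              × ESucc ŝ (Data.Product.proj₁ m₂) false ŝ')))
        where
          s  = EState.st ŝ
          s' = EState.st ŝ'

      IsRun : (ℕ → EState) → Set
      IsRun r = (∀ n → IsEState (r n)) × (∀ n → EStep (r n) (r (suc n)))

      Ωtd : EState → ℕ
      Ωtd ⟪ s , z , false , false , p ⟫ = 0
      Ωtd ⟪ s , z , false , true  , p ⟫ = 1
      Ωtd ⟪ s , z , true  , b     , p ⟫ = suc (suc (toℕ p))

      Ωext : EState → ℕ
      Ωext ŝ = Ωℕ (EState.st ŝ)

□◇ : (ℕ → Set) → Set
□◇ P = ∀ n → ∃[ m ] (n ≤ℕ m × P m)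

◇□ : (ℕ → Set) → Set
◇□ P = ∃[ n ] (∀ m → n ≤ℕ m → P m)

Parity : (ℕ → ℕ) → Set
Parity f = ∃[ k ] (2 ∣ k × □◇ (λ m → f m ≡ k) ×
                   (∀ j → k <ℕ j → ¬ □◇ (λ m → f m ≡ j)))

module Submission where

-- Parity of a bounded index sequence is decided by its eventual maximum: the
-- largest value occurring infinitely often, which the sequence eventually never
-- exceeds.  If time diverges, Ω_td is p + 2 at tick positions and at most 1
-- elsewhere, and p at a tick is the maximum of Ω over the preceding tick
-- interval; hence the eventual maximum of Ω_td is that of Ω shifted by 2, and
-- the shift preserves evenness.  If time converges, eventually Ω_td is 1 exactly
-- where player 1 moved and 0 otherwise, so its eventual maximum is the even
-- value 0 exactly when bl₁ is eventually false.  Excluded middle is used to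
-- case on divergence and to turn "no larger index occurs infinitely often"
-- into "eventually bounded".

open import Defs
open import Level using (0ℓ)
open import Data.Nat using (ℕ; zero; suc; _+_; _⊔_; _≤_; _<_; _≤′_; ≤′-refl; ≤′-step; z≤n; s≤s; z<s)
open import Data.Nat.Properties
open import Data.Nat.Divisibility using (_∣_; _∣0; ∣-refl; ∣1⇒≡1; ∣m∣n⇒∣m+n; ∣m+n∣m⇒∣n)
open import Data.Fin using (Fin; toℕ)
open import Data.Fin.Properties using (toℕ<n)
open import Data.Bool using (Bool; true; false)
open import Data.Product using (_×_; ∃-syntax; _,_)
open import Data.Sum using (_⊎_; inj₁; inj₂)
open import Data.Empty using (⊥-elim)
open import Relation.Nullary using (¬_; yes; no)
open import Relation.Binary.PropositionalEquality using (_≡_; refl; sym; trans; subst; cong)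
open import Function.Bundles using (_⇔_; mk⇔)
open import Axiom.ExcludedMiddle using (ExcludedMiddle)

◇□-map : ∀ {P Q : ℕ → Set} → (∀ n → P n → Q n) → ◇□ P → ◇□ Q
◇□-map f (N , h) = N , λ m N≤m → f m (h m N≤m)

◇□-∩ : ∀ {P Q : ℕ → Set} → ◇□ P → ◇□ Q → ◇□ (λ n → P n × Q n)
◇□-∩ (M , hP) (N , hQ) =
  M ⊔ N , λ m le → hP m (≤-trans (m≤m⊔n M N) le) , hQ m (≤-trans (m≤n⊔m M N) le)

◇□⇒□◇ : ∀ {P : ℕ → Set} → ◇□ P → □◇ P
◇□⇒□◇ (N , h) n = n ⊔ N , m≤m⊔n n N , h (n ⊔ N) (m≤n⊔m n N)

□◇-∩-◇□ : ∀ {P Q : ℕ → Set} → □◇ P → ◇□ Q → □◇ (λ n → P n × Q n)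
□◇-∩-◇□ inf (N , h) n with inf (n ⊔ N)
... | m , n⊔N≤m , pm = m , ≤-trans (m≤m⊔n n N) n⊔N≤m , pm , h m (≤-trans (m≤n⊔m n N) n⊔N≤m)

◇□≤⇒¬□◇> : ∀ {f : ℕ → ℕ} {k j} → ◇□ (λ n → f n ≤ k) → k < j → ¬ □◇ (λ n → f n ≡ j)
◇□≤⇒¬□◇> {k = k} bound k<j inf with □◇-∩-◇□ inf bound 0
... | _ , _ , fm≡j , fm≤k = <⇒≱ k<j (subst (_≤ k) fm≡j fm≤k)

□◇≡-◇□≤⇒≤ : ∀ {f : ℕ → ℕ} {k j} → □◇ (λ n → f n ≡ k) → ◇□ (λ n → f n ≤ j) → k ≤ j
□◇≡-◇□≤⇒≤ inf bound = ≮⇒≥ (λ j<k → ◇□≤⇒¬□◇> bound j<k inf)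

EventualMax : (ℕ → ℕ) → ℕ → Set
EventualMax f k = □◇ (λ n → f n ≡ k) × ◇□ (λ n → f n ≤ k)

evenEventualMax⇒parity : ∀ {f k} → 2 ∣ k → EventualMax f k → Parity f
evenEventualMax⇒parity {k = k} even (inf , bound) =
  k , even , inf , λ j k<j → ◇□≤⇒¬□◇> bound k<j

even≤1⇒≡0 : ∀ {k} → 2 ∣ k → k ≤ 1 → k ≡ 0
even≤1⇒≡0 {zero} _ _ = refl
even≤1⇒≡0 {suc zero} 2∣1 _ with ∣1⇒≡1 2∣1
... | ()
even≤1⇒≡0 {suc (suc _)} _ (s≤s ())

module Classical (lem : ExcludedMiddle 0ℓ) where

  ¬□◇⇒◇□¬ : ∀ {P : ℕ → Set} → ¬ □◇ P → ◇□ (λ n → ¬ P n)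
  ¬□◇⇒◇□¬ {P} ¬inf with lem {◇□ (λ n → ¬ P n)}
  ... | yes ev = ev
  ... | no ¬ev = ⊥-elim (¬inf inf)
    where
    inf : □◇ P
    inf n with lem {∃[ m ] (n ≤ m × P m)}
    ... | yes later = later
    ... | no ¬later = ⊥-elim (¬ev (n , λ m n≤m pm → ¬later (m , n≤m , pm)))

  ◇□≤-lower : ∀ {f : ℕ → ℕ} {k} g → (∀ j → k < j → ¬ □◇ (λ n → f n ≡ j)) →
              ◇□ (λ n → f n ≤ g + k) → ◇□ (λ n → f n ≤ k)
  ◇□≤-lower zero _ bound = bound
  ◇□≤-lower {f} {k} (suc g) rare bound =
    ◇□≤-lower g rare (◇□-map below (◇□-∩ bound (¬□◇⇒◇□¬ (rare _ (s≤s (m≤n+m k g))))))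
    where
    below : ∀ n → f n ≤ suc g + k × ¬ f n ≡ suc g + k → f n ≤ g + k
    below n (le , ne) = ≤-pred (≤∧≢⇒< le ne)

  parity⇒evenEventualMax : ∀ {f : ℕ → ℕ} {B} → (∀ n → f n ≤ B) →
                           Parity f → ∃[ k ] (2 ∣ k × EventualMax f k)
  parity⇒evenEventualMax {B = B} bounded (k , even , inf , rare) =
    k , even , inf , ◇□≤-lower B rare (0 , λ n _ → ≤-trans (bounded n) (m≤m+n B k))

-- p is the running maximum of ω, restarted after every tick.
priorityUpdate : Bool → ℕ → ℕ → ℕ
priorityUpdate false q w = q ⊔ w
priorityUpdate true  _ w = w

module PrioritySequence (tick : ℕ → Bool) (p ω : ℕ → ℕ)
    (p-step : ∀ n → p (suc n) ≡ priorityUpdate (tick n) (p n) (ω (suc n))) where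

  Tick : ℕ → Set
  Tick n = tick n ≡ true

  p-after-tick : ∀ {n} → Tick n → p (suc n) ≡ ω (suc n)
  p-after-tick {n} tn = trans (p-step n) (cong (λ t → priorityUpdate t (p n) (ω (suc n))) tn)

  ω≤p : ∀ n → ω (suc n) ≤ p (suc n)
  ω≤p n with tick n | p-step n
  ... | true  | e = ≤-reflexive (sym e)
  ... | false | e = subst (ω (suc n) ≤_) (sym e) (m≤n⊔m (p n) (ω (suc n)))

  p-since-tick : ∀ {i} → Tick i → ∀ j → i < j → ∃[ m ] (i < m × p j ≡ ω m)
  p-since-tick {i} ti (suc j) i<1+j with m≤n⇒m<n∨m≡n (≤-pred i<1+j)
  ... | inj₂ refl = suc i , n<1+n i , p-after-tick ti
  ... | inj₁ i<j with tick j | p-step j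
  ...   | true  | e = suc j , i<1+j , e
  ...   | false | e with ⊔-sel (p j) (ω (suc j))
  ...     | inj₂ e′ = suc j , i<1+j , trans e e′
  ...     | inj₁ e′ with p-since-tick ti j i<j
  ...       | m , i<m , pj≡ωm = m , i<m , trans e (trans e′ pj≡ωm)

  ω≤p-until-tick : ∀ {m j} → m ≤′ j →
                   ω (suc m) ≤ p (suc j) ⊎ ∃[ i ] (suc m ≤ i × Tick i × ω (suc m) ≤ p i)
  ω≤p-until-tick {m} ≤′-refl = inj₁ (ω≤p m)
  ω≤p-until-tick {m} (≤′-step {j} m≤′j) with ω≤p-until-tick m≤′j
  ... | inj₂ ticked = inj₂ ticked
  ... | inj₁ ωm≤pj with tick (suc j) in tj | p-step (suc j)
  ...   | true  | _ = inj₂ (suc j , s≤s (≤′⇒≤ m≤′j) , tj , ωm≤pj)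
  ...   | false | e = inj₁ (subst (ω (suc m) ≤_) (sym e) (≤-trans ωm≤pj (m≤m⊔n _ _)))

  ω≤p-at-tick : □◇ Tick → ∀ m → ∃[ i ] (suc m ≤ i × Tick i × ω (suc m) ≤ p i)
  ω≤p-at-tick ticks m with ticks (suc m)
  ... | zero , () , _
  ... | suc j , s≤s m≤j , tj with ω≤p-until-tick (≤⇒≤′ m≤j)
  ...   | inj₁ ωm≤pj = suc j , s≤s m≤j , tj , ωm≤pj
  ...   | inj₂ ticked = ticked

  ◇□-ω⇒◇□-p : ∀ {Q : ℕ → Set} → □◇ Tick → ◇□ (λ n → Q (ω n)) → ◇□ (λ n → Q (p n))
  ◇□-ω⇒◇□-p {Q} ticks (N , h) with ticks N
  ... | T , N≤T , tT = suc T , λ j T<j → holds j T<j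
    where
    holds : ∀ j → T < j → Q (p j)
    holds j T<j with p-since-tick tT j T<j
    ... | m , T<m , pj≡ωm = subst Q (sym pj≡ωm) (h m (≤-trans N≤T (<⇒≤ T<m)))

tdIndex : Bool → Bool → ℕ → ℕ
tdIndex false false _ = 0
tdIndex false true  _ = 1
tdIndex true  _     q = suc (suc q)

module TimeDivergentParity (lem : ExcludedMiddle 0ℓ)
    (tick bl : ℕ → Bool) (p ω : ℕ → ℕ) (D : ℕ)
    (p-step : ∀ n → p (suc n) ≡ priorityUpdate (tick n) (p n) (ω (suc n)))
    (ω≤D : ∀ n → ω n ≤ D) (p≤D : ∀ n → p n ≤ D)
    (O : ℕ → ℕ) (O-def : ∀ n → O n ≡ tdIndex (tick n) (bl n) (p n)) where

  open Classical lem
  open PrioritySequence tick p ω p-step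

  O-at-tick : ∀ {n} → Tick n → O n ≡ suc (suc (p n))
  O-at-tick {n} tn rewrite O-def n | tn = refl

  O≤2+p : ∀ n → O n ≤ suc (suc (p n))
  O≤2+p n rewrite O-def n with tick n | bl n
  ... | false | false = z≤n
  ... | false | true  = s≤s z≤n
  ... | true  | _     = ≤-refl

  O≡2+⇒tick : ∀ {n k} → O n ≡ suc (suc k) → Tick n × p n ≡ k
  O≡2+⇒tick {n} e rewrite O-def n with tick n | bl n
  O≡2+⇒tick () | false | false
  O≡2+⇒tick () | false | true
  O≡2+⇒tick refl | true | _ = refl , refl

  O≤1-off-tick : ∀ {n} → ¬ Tick n → O n ≤ 1
  O≤1-off-tick {n} ¬tn rewrite O-def n with tick n | bl n
  ... | true  | _     = ⊥-elim (¬tn refl)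
  ... | false | false = z≤n
  ... | false | true  = ≤-refl

  O-off-tick-bl : ∀ {n} → ¬ Tick n → bl n ≡ true → O n ≡ 1
  O-off-tick-bl {n} ¬tn bn rewrite O-def n | bn with tick n
  ... | true  = ⊥-elim (¬tn refl)
  ... | false = refl

  O-off-tick-¬bl : ∀ {n} → ¬ Tick n → ¬ bl n ≡ true → O n ≡ 0
  O-off-tick-¬bl {n} ¬tn ¬bn rewrite O-def n with tick n | bl n
  ... | true  | _     = ⊥-elim (¬tn refl)
  ... | false | true  = ⊥-elim (¬bn refl)
  ... | false | false = refl

  module Ticking (ticks : □◇ Tick) where

    eventualMax-ω⇒O : ∀ {k} → EventualMax ω k → EventualMax O (suc (suc k))
    eventualMax-ω⇒O {k} (ω-inf , ω≤k) =
      O-inf , ◇□-map (λ n p≤k → ≤-trans (O≤2+p n) (s≤s (s≤s p≤k))) p≤k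
      where
      p≤k : ◇□ (λ n → p n ≤ k)
      p≤k = ◇□-ω⇒◇□-p {_≤ k} ticks ω≤k
      O-inf : □◇ (λ n → O n ≡ suc (suc k))
      O-inf n with p≤k
      ... | N , h with ω-inf (suc (n ⊔ N))
      ...   | zero , () , _
      ...   | suc m , s≤s n⊔N≤m , ωm≡k with ω≤p-at-tick ticks m
      ...     | i , m<i , ti , ωm≤pi =
        let n⊔N≤i = ≤-trans n⊔N≤m (<⇒≤ m<i)
            pi≡k  = ≤-antisym (h i (≤-trans (m≤n⊔m n N) n⊔N≤i)) (subst (_≤ p i) ωm≡k ωm≤pi)
        in i , ≤-trans (m≤m⊔n n N) n⊔N≤i , trans (O-at-tick ti) (cong (λ q → suc (suc q)) pi≡k)

    ◇□-O≤⇒2≤ : ∀ {k} → ◇□ (λ n → O n ≤ k) → 2 ≤ k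
    ◇□-O≤⇒2≤ {k} (N , h) with ticks N
    ... | T , N≤T , tT = ≤-trans (s≤s (s≤s z≤n)) (subst (_≤ k) (O-at-tick tT) (h T N≤T))

    eventualMax-O⇒ω : ∀ {k} → EventualMax O (suc (suc k)) → EventualMax ω k
    eventualMax-O⇒ω {k} (O-inf , (N , O≤2+k)) = ω-inf , (suc N , ω≤k)
      where
      ω≤k : ∀ n → suc N ≤ n → ω n ≤ k
      ω≤k (suc m) (s≤s N≤m) with ω≤p-at-tick ticks m
      ... | i , m<i , ti , ωm≤pi =
        ≤-trans ωm≤pi (≤-pred (≤-pred (subst (_≤ _) (O-at-tick ti) (O≤2+k i (≤-trans N≤m (<⇒≤ m<i))))))
      ω-inf : □◇ (λ n → ω n ≡ k)
      ω-inf n with ticks n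
      ... | i , n≤i , ti with O-inf (suc i)
      ...   | j , i<j , Oj≡2+k with O≡2+⇒tick Oj≡2+k | p-since-tick ti j i<j
      ...     | _ , pj≡k | m , i<m , pj≡ωm = m , ≤-trans n≤i (<⇒≤ i<m) , trans (sym pj≡ωm) pj≡k

    evenEventualMax-O⇒parity-ω : ∀ k → 2 ∣ k → EventualMax O k → Parity ω
    evenEventualMax-O⇒parity-ω zero _ (_ , O≤0) with ◇□-O≤⇒2≤ O≤0
    ... | ()
    evenEventualMax-O⇒parity-ω (suc zero) _ (_ , O≤1) with ◇□-O≤⇒2≤ O≤1
    ... | s≤s ()
    evenEventualMax-O⇒parity-ω (suc (suc k)) even max =
      evenEventualMax⇒parity (∣m+n∣m⇒∣n even ∣-refl) (eventualMax-O⇒ω max)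

  module NotTicking (quiet : ◇□ (λ n → ¬ Tick n)) where

    ◇□¬bl⇒eventualMax-O : ◇□ (λ n → ¬ bl n ≡ true) → EventualMax O 0
    ◇□¬bl⇒eventualMax-O ¬bl = ◇□⇒□◇ O≡0 , ◇□-map (λ _ → ≤-reflexive) O≡0
      where
      O≡0 : ◇□ (λ n → O n ≡ 0)
      O≡0 = ◇□-map (λ _ (¬tn , ¬bn) → O-off-tick-¬bl ¬tn ¬bn) (◇□-∩ quiet ¬bl)

    evenEventualMax-O⇒◇□¬bl : ∀ {k} → 2 ∣ k → EventualMax O k → ◇□ (λ n → ¬ bl n ≡ true)
    evenEventualMax-O⇒◇□¬bl {k} even (O-inf , O≤k) =
      ◇□-map (λ _ (¬tn , On≤0) bn → <⇒≱ z<s (subst (_≤ 0) (O-off-tick-bl ¬tn bn) On≤0))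
             (◇□-∩ quiet O≤0)
      where
      k≡0 : k ≡ 0
      k≡0 = even≤1⇒≡0 even (□◇≡-◇□≤⇒≤ O-inf (◇□-map (λ _ → O≤1-off-tick) quiet))
      O≤0 : ◇□ (λ n → O n ≤ 0)
      O≤0 = subst (λ k → ◇□ (λ n → O n ≤ k)) k≡0 O≤k

  timeDivBl₁⇔parity : ((□◇ Tick → Parity ω) × (¬ □◇ Tick → ◇□ (λ n → ¬ bl n ≡ true)))
                      ⇔ Parity O
  timeDivBl₁⇔parity = mk⇔ to from
    where
    to : (□◇ Tick → Parity ω) × (¬ □◇ Tick → ◇□ (λ n → ¬ bl n ≡ true)) → Parity O
    to (diverging , converging) with lem {□◇ Tick}
    ... | yes ticks with parity⇒evenEventualMax ω≤D (diverging ticks)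
    ...   | k , even , max = evenEventualMax⇒parity (∣m∣n⇒∣m+n ∣-refl even)
                                                    (Ticking.eventualMax-ω⇒O ticks max)
    to (diverging , converging) | no ¬ticks =
      evenEventualMax⇒parity (2 ∣0)
        (NotTicking.◇□¬bl⇒eventualMax-O (¬□◇⇒◇□¬ ¬ticks) (converging ¬ticks))

    from : Parity O → (□◇ Tick → Parity ω) × (¬ □◇ Tick → ◇□ (λ n → ¬ bl n ≡ true))
    from par with parity⇒evenEventualMax (λ n → ≤-trans (O≤2+p n) (s≤s (s≤s (p≤D n)))) par
    ... | k , even , max =
      (λ ticks → Ticking.evenEventualMax-O⇒parity-ω ticks k even max) ,
      (λ ¬ticks → NotTicking.evenEventualMax-O⇒◇□¬bl (¬□◇⇒◇□¬ ¬ticks) even max)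

module _ (R : Reals) (G : TAGame) (d : ℕ) (Ω : RawState R G → Fin d) where

  ESucc-priority : ∀ ŝ Δ bl ŝ′ → ESucc R G d Ω ŝ Δ bl ŝ′ →
                   toℕ (EState.p ŝ′) ≡
                   priorityUpdate (EState.tick ŝ) (toℕ (EState.p ŝ)) (Ωext R G d Ω ŝ′)
  ESucc-priority ⟪ _ , _ , false , _ , _ ⟫ _ _ _ (_ , _ , _ , _ , e) = e
  ESucc-priority ⟪ _ , _ , true  , _ , _ ⟫ _ _ _ (_ , _ , _ , _ , e) = e

  EStep-priority : ∀ ŝ ŝ′ → EStep R G d Ω ŝ ŝ′ →
                   toℕ (EState.p ŝ′) ≡
                   priorityUpdate (EState.tick ŝ) (toℕ (EState.p ŝ)) (Ωext R G d Ω ŝ′)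
  EStep-priority ŝ ŝ′ (_ , _ , _ , _ , inj₁ (_ , _ , succ)) = ESucc-priority ŝ _ _ ŝ′ succ
  EStep-priority ŝ ŝ′ (_ , _ , _ , _ , inj₂ (_ , _ , succ)) = ESucc-priority ŝ _ _ ŝ′ succ

  Ωtd≡tdIndex : ∀ ŝ → Ωtd R G d Ω ŝ ≡ tdIndex (EState.tick ŝ) (EState.bl₁ ŝ) (toℕ (EState.p ŝ))
  Ωtd≡tdIndex ⟪ _ , _ , false , false , _ ⟫ = refl
  Ωtd≡tdIndex ⟪ _ , _ , false , true  , _ ⟫ = refl
  Ωtd≡tdIndex ⟪ _ , _ , true  , _     , _ ⟫ = refl

lemma2p5 : (R : Reals) (G : TAGame) (d : ℕ) (Ω : RawState R G → Fin d) →
           ExcludedMiddle 0ℓ →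
           (r : ℕ → EState R G d Ω) → IsRun R G d Ω r →
           (((□◇ (λ n → EState.tick (r n) ≡ true) → Parity (λ n → Ωext R G d Ω (r n)))
             × (¬ □◇ (λ n → EState.tick (r n) ≡ true) → ◇□ (λ n → ¬ (EState.bl₁ (r n) ≡ true))))
            ⇔ Parity (λ n → Ωtd R G d Ω (r n)))
lemma2p5 R G d Ω lem r (_ , steps) =
  TimeDivergentParity.timeDivBl₁⇔parity lem
    (λ n → EState.tick (r n)) (λ n → EState.bl₁ (r n))
    (λ n → toℕ (EState.p (r n))) (λ n → Ωext R G d Ω (r n)) d
    (λ n → EStep-priority R G d Ω (r n) (r (suc n)) (steps n))
    (λ n → <⇒≤ (toℕ<n (Ω (EState.st (r n))))) (λ n → <⇒≤ (toℕ<n (EState.p (r n))))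
    (λ n → Ωtd R G d Ω (r n)) (λ n → Ωtd≡tdIndex R G d Ω (r n))
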